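{- Let $B$ be the following $9\times 9$ matrix over $\mathrm{GF}(2)$: \[ B=\begin{pmatrix} 0 & 0 & 0 & 1 & 1 & 1 & 1 & 1 & 1 \\ 0 & 1 & 1 & 1 & 0 & 0 & 1 & 1 & 1 \\ 0 & 0 & 1 & 0 & 0 & 1 & 0 & 1 & 1 \\ 1 & 1 & 0 & 0 & 1 & 0 & 0 & 1 & 1 \\ 1 & 1 & 1 & 0 & 0 & 1 & 1 & 1 & 0 \\ 1 & 1 & 0 & 1 & 0 & 1 & 0 & 1 & 1 \\ 1 & 0 & 1 & 0 & 1 & 0 & 1 & 1 & 1 \\ 0 & 1 & 0 & 0 & 1 & 1 & 1 & 1 & 0 \\ 1 & 0 & 1 & 1 & 1 & 1 & 0 & 1 & 0 \end{pmatrix}, \] and let $N'$ be the binary matroid on $18$ elements represented over $\mathrm{GF}(2)$ by the $9\times 18$ matrix $[I_9\mid B]$. Then there exists an integer $z$ such that $T_{N'}(-1+4z,-1+4z)/T_{N'}(-1,-1)$ is not an odd integer.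
   Context: For a matroid $M$ on ground set $E$ with rank function $r$, the Tutte polynomial is $T_M(x,y)=\sum_{S\subseteq E}(x-1)^{r(E)-r(S)}(y-1)^{|S|-r(S)}$. The matroid represented by a matrix over $\mathrm{GF}(2)$ has the columns as elements, a set being independent iff the corresponding columns are linearly independent over $\mathrm{GF}(2)$. $I_9$ denotes the $9\times 9$ identity matrix. -}

module Defs where

open import Data.Bool using (Bool; true; false; _∧_; _∨_; not; _xor_; if_then_else_)
open import Data.Nat using (ℕ; zero; suc; _∸_; _⊔_)
open import Data.Integer using (ℤ; +_; _+_; _-_; _*_; _^_)
open import Data.Fin using (Fin; _≟_)
open import Data.List using (List; []; _∷_; _++_; map; foldr; filterᵇ)
open import Data.Vec using (Vec; []; _∷_; tabulate; zipWith; lookup)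
  renaming (map to vmap; foldr′ to vfoldr′; _++_ to _v++_)
open import Relation.Nullary.Decidable using (⌊_⌋)

-- GF(2) is modelled by Bool: addition = xor, multiplication = ∧.

Matrix : ℕ → ℕ → Set
Matrix m n = Vec (Vec Bool n) m

-- A subset of the ground set {0,…,n-1} (the columns), as its indicator vector.
SubsetE : ℕ → Set
SubsetE n = Vec Bool n

allSubsets : (n : ℕ) → List (SubsetE n)
allSubsets zero = [] ∷ []
allSubsets (suc n) = map (false ∷_) (allSubsets n) ++ map (true ∷_) (allSubsets n)

size : {n : ℕ} → SubsetE n → ℕ
size [] = 0
size (true ∷ s) = suc (size s)
size (false ∷ s) = size s

_⊆ᵇ_ : {n : ℕ} → SubsetE n → SubsetE n → Bool
[] ⊆ᵇ [] = true
(a ∷ s) ⊆ᵇ (b ∷ t) = (not a ∨ b) ∧ (s ⊆ᵇ t)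

isEmpty : {n : ℕ} → SubsetE n → Bool
isEmpty [] = true
isEmpty (a ∷ s) = not a ∧ isEmpty s

isZeroVec : {m : ℕ} → Vec Bool m → Bool
isZeroVec [] = true
isZeroVec (a ∷ v) = not a ∧ isZeroVec v

rowSum : {n : ℕ} → Vec Bool n → SubsetE n → Bool
rowSum row T = vfoldr′ _xor_ false (zipWith _∧_ row T)

colSum : {m n : ℕ} → Matrix m n → SubsetE n → Vec Bool m
colSum A T = vmap (λ row → rowSum row T) A

allᵇ : {A : Set} → (A → Bool) → List A → Bool
allᵇ p = foldr (λ a b → p a ∧ b) true

-- Columns indexed by I are linearly independent over GF(2):
-- (coefficients lie in {0,1}) no nonempty subfamily T ⊆ I sums to zero.
independentᵇ : {m n : ℕ} → Matrix m n → SubsetE n → Bool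
independentᵇ {n = n} A I =
  allᵇ (λ T → not (T ⊆ᵇ I) ∨ not (isZeroVec (colSum A T)) ∨ isEmpty T) (allSubsets n)

maxList : List ℕ → ℕ
maxList = foldr _⊔_ 0

rank : {m n : ℕ} → Matrix m n → SubsetE n → ℕ
rank {n = n} A S =
  maxList (map size (filterᵇ (λ I → (I ⊆ᵇ S) ∧ independentᵇ A I) (allSubsets n)))

fullSet : (n : ℕ) → SubsetE n
fullSet n = tabulate (λ _ → true)

sumℤ : List ℤ → ℤ
sumℤ = foldr _+_ (+ 0)

tutte : {m n : ℕ} → Matrix m n → ℤ → ℤ → ℤ
tutte {n = n} A x y =
  sumℤ (map (λ S → ((x - + 1) ^ (rank A (fullSet n) ∸ rank A S))
                 * ((y - + 1) ^ (size S ∸ rank A S)))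
            (allSubsets n))

identity : (k : ℕ) → Matrix k k
identity k = tabulate (λ i → tabulate (λ j → ⌊ i ≟ j ⌋))

_∣∣_ : {m p q : ℕ} → Matrix m p → Matrix m q → Matrix m (Data.Nat._+_ p q)
A ∣∣ C = zipWith _v++_ A C

private
  O I : Bool
  O = false
  I = true

B : Matrix 9 9
B = (O ∷ O ∷ O ∷ I ∷ I ∷ I ∷ I ∷ I ∷ I ∷ [])
  ∷ (O ∷ I ∷ I ∷ I ∷ O ∷ O ∷ I ∷ I ∷ I ∷ [])
  ∷ (O ∷ O ∷ I ∷ O ∷ O ∷ I ∷ O ∷ I ∷ I ∷ [])
  ∷ (I ∷ I ∷ O ∷ O ∷ I ∷ O ∷ O ∷ I ∷ I ∷ [])
  ∷ (I ∷ I ∷ I ∷ O ∷ O ∷ I ∷ I ∷ I ∷ O ∷ [])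
  ∷ (I ∷ I ∷ O ∷ I ∷ O ∷ I ∷ O ∷ I ∷ I ∷ [])
  ∷ (I ∷ O ∷ I ∷ O ∷ I ∷ O ∷ I ∷ I ∷ I ∷ [])
  ∷ (O ∷ I ∷ O ∷ O ∷ I ∷ I ∷ I ∷ I ∷ O ∷ [])
  ∷ (I ∷ O ∷ I ∷ I ∷ I ∷ I ∷ O ∷ I ∷ O ∷ [])
  ∷ []

N′ : Matrix 9 18
N′ = identity 9 ∣∣ B

-- The rank function maximises over all subsets, far too much to evaluate for
-- 18 columns. It coincides with the size of the basis found by greedy Gaussian
-- elimination over GF(2): the greedy columns are independent, and the pivot
-- coordinates against the greedy basis embed GF(2)^|I| linearly into
-- GF(2)^rank for every independent I, so |I| ≤ rank by counting. The Tutte sum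
-- is then one traversal of the binary tree of subsets that shares the
-- elimination state along each branch, and evaluates to T(-1,-1) = 64 and
-- T(-5,-5) = -368640 = 64 · 2 · (-2880), an even multiple.

module Submission where

open import Algebra.Bundles using (CommutativeSemigroup)
import Algebra.Properties.CommutativeSemigroup as CommutativeSemigroupProperties
open import Data.Bool using (Bool; true; false; not; _∧_; _∨_; _xor_; if_then_else_)
open import Data.Bool.Properties
  using (xor-assoc; xor-comm; xor-same; xor-identityˡ; xor-identityʳ; ∧-identityʳ; ∧-zeroʳ)
open import Data.Empty using (⊥-elim)
open import Data.Fin using (Fin)
open import Data.Fin.Properties using (2↔Bool; injective⇒≤)
open import Data.Integer using (ℤ; +_; -_; _+_; _*_; _-_; _^_; ∣_∣)
import Data.Integer.Properties as ℤₚ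
open import Data.Integer.Tactic.RingSolver using (solve-∀)
open import Data.List using (List; []; _∷_; _++_; _∷ʳ_; foldl; length; map; filterᵇ)
open import Data.List.Properties using (length-++; map-++; map-∘; map-cong)
open import Data.List.Membership.Propositional using (_∈_)
open import Data.List.Membership.Propositional.Properties using (∈-++⁺ˡ; ∈-++⁺ʳ; ∈-map⁺)
open import Data.List.Relation.Unary.All using (All; []; _∷_) renaming (lookup to lookupAll)
open import Data.List.Relation.Unary.All.Properties using (∷ʳ⁺)
open import Data.List.Relation.Unary.Any using (here; there)
open import Data.Nat as ℕ using (ℕ; zero; suc; _≤_; _∸_; z≤n; s≤s)
open import Data.Nat.Divisibility using (divides; ∣1⇒≡1)
import Data.Nat.Properties as ℕₚ
open import Data.Nat.Properties
  using (≤-antisym; ≤-trans; ⊔-lub; m≤m⊔n; m≤n⊔m; ≮⇒≥; <⇒≱; ^-monoʳ-<)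
open import Data.Product using (∃; _×_; _,_; proj₁; proj₂)
open import Data.Sum using (_⊎_; inj₁; inj₂)
open import Data.Unit using (⊤; tt)
open import Data.Vec using (Vec; []; _∷_; zipWith; replicate; head; tail)
  renaming (map to mapᵥ)
open import Data.Vec.Properties using (zipWith-assoc; zipWith-comm; zipWith-identityˡ; zipWith-identityʳ)
open import Data.Vec.Recursive using (Fin[m^n]↔Fin[m]^n; lift↔)
open import Data.Vec.Recursive.Properties using (↔Vec)
open import Function using (_∘_; _↔_; _↣_; Injection; Injective; mk↣)
open import Function.Construct.Composition using (_↣-∘_)
open import Function.Properties.Inverse using (↔⇒↣; ↔-sym; ↔-trans)
open import Level using (0ℓ)
open import Relation.Binary.PropositionalEquality
  using (_≡_; _≢_; refl; sym; trans; cong; cong₂; subst; isEquivalence; module ≡-Reasoning)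
open import Relation.Nullary using (¬_)

open import Defs

-- Vectors over GF(2)

infixl 6 _⊕_

_⊕_ : ∀ {m} → Vec Bool m → Vec Bool m → Vec Bool m
_⊕_ = zipWith _xor_

𝟘 : ∀ {m} → Vec Bool m
𝟘 = replicate _ false

⊕-assoc : ∀ {m} (u v w : Vec Bool m) → u ⊕ v ⊕ w ≡ u ⊕ (v ⊕ w)
⊕-assoc = zipWith-assoc xor-assoc

⊕-comm : ∀ {m} (u v : Vec Bool m) → u ⊕ v ≡ v ⊕ u
⊕-comm = zipWith-comm xor-comm

⊕-identityˡ : ∀ {m} (u : Vec Bool m) → 𝟘 ⊕ u ≡ u
⊕-identityˡ = zipWith-identityˡ xor-identityˡ

⊕-identityʳ : ∀ {m} (u : Vec Bool m) → u ⊕ 𝟘 ≡ u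
⊕-identityʳ = zipWith-identityʳ xor-identityʳ

⊕-self : ∀ {m} (u : Vec Bool m) → u ⊕ u ≡ 𝟘
⊕-self []      = refl
⊕-self (x ∷ u) = cong₂ _∷_ (xor-same x) (⊕-self u)

⊕-cancelˡ : ∀ {m} (u v : Vec Bool m) → u ⊕ (u ⊕ v) ≡ v
⊕-cancelˡ u v = begin
  u ⊕ (u ⊕ v) ≡⟨ ⊕-assoc u u v ⟨
  u ⊕ u ⊕ v   ≡⟨ cong (_⊕ v) (⊕-self u) ⟩
  𝟘 ⊕ v       ≡⟨ ⊕-identityˡ v ⟩
  v           ∎
  where open ≡-Reasoning

⊕≡𝟘⇒≡ : ∀ {m} {u v : Vec Bool m} → u ⊕ v ≡ 𝟘 → u ≡ v
⊕≡𝟘⇒≡ {u = u} {v} u⊕v≡𝟘 = begin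
  u           ≡⟨ ⊕-identityʳ u ⟨
  u ⊕ 𝟘       ≡⟨ cong (u ⊕_) u⊕v≡𝟘 ⟨
  u ⊕ (u ⊕ v) ≡⟨ ⊕-cancelˡ u v ⟩
  v           ∎
  where open ≡-Reasoning

⊕-commutativeSemigroup : ℕ → CommutativeSemigroup 0ℓ 0ℓ
⊕-commutativeSemigroup m = record
  { Carrier = Vec Bool m
  ; _≈_     = _≡_
  ; _∙_     = _⊕_
  ; isCommutativeSemigroup = record
    { isSemigroup = record
      { isMagma = record { isEquivalence = isEquivalence ; ∙-cong = cong₂ _⊕_ }
      ; assoc   = ⊕-assoc
      }
    ; comm = ⊕-comm
    }
  }

module _ {m : ℕ} where
  open CommutativeSemigroupProperties (⊕-commutativeSemigroup m) public
    using () renaming (interchange to ⊕-interchange; x∙yz≈y∙xz to ⊕-leftComm)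

true≢false : true ≢ false
true≢false ()

isZeroVec⇒≡𝟘 : ∀ {m} (v : Vec Bool m) → isZeroVec v ≡ true → v ≡ 𝟘
isZeroVec⇒≡𝟘 []          _  = refl
isZeroVec⇒≡𝟘 (false ∷ v) eq = cong (false ∷_) (isZeroVec⇒≡𝟘 v eq)

isZeroVec-𝟘 : ∀ m → isZeroVec (𝟘 {m}) ≡ true
isZeroVec-𝟘 zero    = refl
isZeroVec-𝟘 (suc m) = isZeroVec-𝟘 m

isEmpty≡isZeroVec : ∀ {n} (T : SubsetE n) → isEmpty T ≡ isZeroVec T
isEmpty≡isZeroVec []      = refl
isEmpty≡isZeroVec (t ∷ T) = cong (not t ∧_) (isEmpty≡isZeroVec T)

-- Spans

data Span {m} (X : List (Vec Bool m)) : Vec Bool m → Set where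
  span-𝟘   : Span X 𝟘
  span-add : ∀ {x v} → x ∈ X → Span X v → Span X (x ⊕ v)

span-⊕ : ∀ {m} {X : List (Vec Bool m)} {u v} → Span X u → Span X v → Span X (u ⊕ v)
span-⊕ {v = v} span-𝟘 sv = subst (Span _) (sym (⊕-identityˡ v)) sv
span-⊕ {v = v} (span-add {x} {u} x∈X su) sv =
  subst (Span _) (sym (⊕-assoc x u v)) (span-add x∈X (span-⊕ su sv))

span-∈ : ∀ {m} {X : List (Vec Bool m)} {x} → x ∈ X → Span X x
span-∈ {x = x} x∈X = subst (Span _) (⊕-identityʳ x) (span-add x∈X span-𝟘)

span-mono : ∀ {m} {X Y : List (Vec Bool m)} →
            (∀ {x} → x ∈ X → Span Y x) → ∀ {v} → Span X v → Span Y v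
span-mono X⊆Y span-𝟘          = span-𝟘
span-mono X⊆Y (span-add x∈ s) = span-⊕ (X⊆Y x∈) (span-mono X⊆Y s)

span-∷ʳ⁺ : ∀ {m} {X : List (Vec Bool m)} {u v} → Span X v → Span (X ∷ʳ u) v
span-∷ʳ⁺ = span-mono (λ x∈X → span-∈ (∈-++⁺ˡ x∈X))

span-∷ʳ : ∀ {m} (X : List (Vec Bool m)) u → Span (X ∷ʳ u) u
span-∷ʳ X u = span-∈ (∈-++⁺ʳ X (here refl))

span-uncons : ∀ {m} {b : Vec Bool m} {X w} → Span (b ∷ X) w → Span X w ⊎ Span X (b ⊕ w)
span-uncons span-𝟘 = inj₁ span-𝟘
span-uncons {b = b} (span-add {v = v} (here refl) s) with span-uncons s
... | inj₁ sv  = inj₂ (subst (Span _) (sym (⊕-cancelˡ b v)) sv)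
... | inj₂ sbv = inj₁ sbv
span-uncons {b = b} (span-add {x} {v} (there x∈X) s) with span-uncons s
... | inj₁ sv  = inj₁ (span-add x∈X sv)
... | inj₂ sbv = inj₂ (subst (Span _) (⊕-leftComm x b v) (span-add x∈X sbv))

-- Echelon lists and reduction

atPivot : ∀ {m} → Vec Bool m → Vec Bool m → Bool
atPivot []          []      = false
atPivot (true ∷ b)  (x ∷ u) = x
atPivot (false ∷ b) (x ∷ u) = atPivot b u

atPivot-⊕ : ∀ {m} (b u v : Vec Bool m) → atPivot b (u ⊕ v) ≡ atPivot b u xor atPivot b v
atPivot-⊕ []          []      []      = refl
atPivot-⊕ (true ∷ b)  (x ∷ u) (y ∷ v) = refl
atPivot-⊕ (false ∷ b) (x ∷ u) (y ∷ v) = atPivot-⊕ b u v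

atPivot-𝟘 : ∀ {m} (b : Vec Bool m) → atPivot b 𝟘 ≡ false
atPivot-𝟘 []          = refl
atPivot-𝟘 (true ∷ b)  = refl
atPivot-𝟘 (false ∷ b) = atPivot-𝟘 b

atPivot-self : ∀ {m} (b : Vec Bool m) → isZeroVec b ≡ false → atPivot b b ≡ true
atPivot-self (true ∷ b)  _  = refl
atPivot-self (false ∷ b) eq = atPivot-self b eq

atPivot-span : ∀ {m} (b : Vec Bool m) {X} → All (λ x → atPivot b x ≡ false) X →
               ∀ {w} → Span X w → atPivot b w ≡ false
atPivot-span b _ span-𝟘 = atPivot-𝟘 b
atPivot-span b X-clear (span-add {x} {v} x∈X s) = begin
  atPivot b (x ⊕ v)             ≡⟨ atPivot-⊕ b x v ⟩
  atPivot b x xor atPivot b v   ≡⟨ cong₂ _xor_ (lookupAll X-clear x∈X) (atPivot-span b X-clear s) ⟩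
  false                         ∎
  where open ≡-Reasoning

VanishesAtPivots : ∀ {m} → List (Vec Bool m) → Vec Bool m → Set
VanishesAtPivots bs u = All (λ b → atPivot b u ≡ false) bs

-- atPivot b b ≡ true says that b ≠ 𝟘.
Echelon : ∀ {m} → List (Vec Bool m) → Set
Echelon []       = ⊤
Echelon (b ∷ bs) = atPivot b b ≡ true × All (λ c → atPivot b c ≡ false) bs × Echelon bs

echelon-∷ʳ : ∀ {m} (bs : List (Vec Bool m)) {u} →
             Echelon bs → atPivot u u ≡ true → VanishesAtPivots bs u → Echelon (bs ∷ʳ u)
echelon-∷ʳ []       _                    uu []          = uu , [] , tt
echelon-∷ʳ (b ∷ bs) (bb , b-clear , ech) uu (ub ∷ vu) = bb , ∷ʳ⁺ b-clear ub , echelon-∷ʳ bs ech uu vu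

echelon-span-vanishing⇒𝟘 : ∀ {m} (bs : List (Vec Bool m)) → Echelon bs →
                           ∀ {w} → Span bs w → VanishesAtPivots bs w → w ≡ 𝟘
echelon-span-vanishing⇒𝟘 [] _ span-𝟘 _ = refl
echelon-span-vanishing⇒𝟘 [] _ (span-add () _) _
echelon-span-vanishing⇒𝟘 (b ∷ bs) (bb , b-clear , ech) {w} s (wb ∷ vw) with span-uncons s
... | inj₁ sw  = echelon-span-vanishing⇒𝟘 bs ech sw vw
... | inj₂ sbw = ⊥-elim (true≢false (begin
  true                          ≡⟨ cong₂ _xor_ bb wb ⟨
  atPivot b b xor atPivot b w   ≡⟨ atPivot-⊕ b b w ⟨
  atPivot b (b ⊕ w)             ≡⟨ atPivot-span b b-clear sbw ⟩
  false                         ∎))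
  where open ≡-Reasoning

reduceBy : ∀ {m} → Vec Bool m → Vec Bool m → Vec Bool m
reduceBy v b = if atPivot b v then v ⊕ b else v

reduce : ∀ {m} → List (Vec Bool m) → Vec Bool m → Vec Bool m
reduce bs v = foldl reduceBy v bs

reduceBy-span : ∀ {m} (b : Vec Bool m) X v → Span (b ∷ X) (v ⊕ reduceBy v b)
reduceBy-span b X v with atPivot b v
... | true  = subst (Span _) (sym (⊕-cancelˡ v b)) (span-∈ (here refl))
... | false = subst (Span _) (sym (⊕-self v)) span-𝟘

reduceBy-clears : ∀ {m} (b v : Vec Bool m) → atPivot b b ≡ true → atPivot b (reduceBy v b) ≡ false
reduceBy-clears b v bb with atPivot b v in bv
... | true  = trans (atPivot-⊕ b v b) (cong₂ _xor_ bv bb)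
... | false = bv

reduce-span : ∀ {m} (bs : List (Vec Bool m)) v → Span bs (v ⊕ reduce bs v)
reduce-span []       v = subst (Span []) (sym (⊕-self v)) span-𝟘
reduce-span (b ∷ bs) v = subst (Span _) (begin
  (v ⊕ u) ⊕ (u ⊕ reduce bs u)   ≡⟨ ⊕-assoc v u _ ⟩
  v ⊕ (u ⊕ (u ⊕ reduce bs u))   ≡⟨ cong (v ⊕_) (⊕-cancelˡ u _) ⟩
  v ⊕ reduce bs u               ∎)
  (span-⊕ (reduceBy-span b bs v) (span-mono (λ x∈ → span-∈ (there x∈)) (reduce-span bs u)))
  where
  open ≡-Reasoning
  u = reduceBy v b

reduce-vanishesAtPivots : ∀ {m} (bs : List (Vec Bool m)) → Echelon bs → ∀ v → VanishesAtPivots bs (reduce bs v)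
reduce-vanishesAtPivots []       _                    v = []
reduce-vanishesAtPivots (b ∷ bs) (bb , b-clear , ech) v =
  cleared ∷ reduce-vanishesAtPivots bs ech u
  where
  open ≡-Reasoning
  u = reduceBy v b
  -- reduce bs only adds vectors from the span of bs, which vanish at the pivot of b.
  cleared : atPivot b (reduce bs u) ≡ false
  cleared = begin
    atPivot b (reduce bs u)                               ≡⟨ cong (atPivot b) (⊕-cancelˡ u _) ⟨
    atPivot b (u ⊕ (u ⊕ reduce bs u))                     ≡⟨ atPivot-⊕ b u _ ⟩
    atPivot b u xor atPivot b (u ⊕ reduce bs u)           ≡⟨ cong₂ _xor_ (reduceBy-clears b v bb)
                                                              (atPivot-span b b-clear (reduce-span bs u)) ⟩
    false                                                 ∎

span⇒reduce≡𝟘 : ∀ {m} (bs : List (Vec Bool m)) → Echelon bs → ∀ {v} → Span bs v → reduce bs v ≡ 𝟘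
span⇒reduce≡𝟘 bs ech {v} sv = echelon-span-vanishing⇒𝟘 bs ech
  (subst (Span bs) (⊕-cancelˡ v _) (span-⊕ sv (reduce-span bs v)))
  (reduce-vanishesAtPivots bs ech v)

reduce≡𝟘⇒span : ∀ {m} (bs : List (Vec Bool m)) v → reduce bs v ≡ 𝟘 → Span bs v
reduce≡𝟘⇒span bs v r≡𝟘 =
  subst (Span bs) (trans (cong (v ⊕_) r≡𝟘) (⊕-identityʳ v)) (reduce-span bs v)

span-∷ʳ-reduce : ∀ {m} (bs : List (Vec Bool m)) v → Span (bs ∷ʳ reduce bs v) v
span-∷ʳ-reduce bs v = subst (Span _) (begin
  v ⊕ r ⊕ r     ≡⟨ ⊕-assoc v r r ⟩
  v ⊕ (r ⊕ r)   ≡⟨ cong (v ⊕_) (⊕-self r) ⟩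
  v ⊕ 𝟘         ≡⟨ ⊕-identityʳ v ⟩
  v             ∎)
  (span-⊕ (span-∷ʳ⁺ (reduce-span bs v)) (span-∷ʳ bs r))
  where
  open ≡-Reasoning
  r = reduce bs v

echelon-∷ʳ-reduce : ∀ {m} (bs : List (Vec Bool m)) v →
                    Echelon bs → isZeroVec (reduce bs v) ≡ false → Echelon (bs ∷ʳ reduce bs v)
echelon-∷ʳ-reduce bs v ech r≢𝟘 =
  echelon-∷ʳ bs ech (atPivot-self (reduce bs v) r≢𝟘) (reduce-vanishesAtPivots bs ech v)

-- The greedy basis of a set of columns

lincomb : ∀ {m k} → Vec (Vec Bool m) k → SubsetE k → Vec Bool m
lincomb []       []      = 𝟘
lincomb (c ∷ cs) (t ∷ T) = if t then c ⊕ lincomb cs T else lincomb cs T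

lincomb-𝟘 : ∀ {m k} (cs : Vec (Vec Bool m) k) → lincomb cs 𝟘 ≡ 𝟘
lincomb-𝟘 []       = refl
lincomb-𝟘 (c ∷ cs) = lincomb-𝟘 cs

lincomb-⊕ : ∀ {m k} (cs : Vec (Vec Bool m) k) T T′ → lincomb cs (T ⊕ T′) ≡ lincomb cs T ⊕ lincomb cs T′
lincomb-⊕ []       []          []           = sym (⊕-self 𝟘)
lincomb-⊕ (c ∷ cs) (false ∷ T) (false ∷ T′) = lincomb-⊕ cs T T′
lincomb-⊕ (c ∷ cs) (false ∷ T) (true ∷ T′)  =
  trans (cong (c ⊕_) (lincomb-⊕ cs T T′)) (⊕-leftComm c _ _)
lincomb-⊕ (c ∷ cs) (true ∷ T)  (false ∷ T′) =
  trans (cong (c ⊕_) (lincomb-⊕ cs T T′)) (sym (⊕-assoc c _ _))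
lincomb-⊕ (c ∷ cs) (true ∷ T)  (true ∷ T′)  = begin
  lincomb cs (T ⊕ T′)       ≡⟨ lincomb-⊕ cs T T′ ⟩
  a ⊕ b                     ≡⟨ ⊕-identityˡ _ ⟨
  𝟘 ⊕ (a ⊕ b)               ≡⟨ cong (_⊕ (a ⊕ b)) (⊕-self c) ⟨
  c ⊕ c ⊕ (a ⊕ b)           ≡⟨ ⊕-interchange c c a b ⟩
  c ⊕ a ⊕ (c ⊕ b)           ∎
  where
  open ≡-Reasoning
  a = lincomb cs T
  b = lincomb cs T′

-- Scanning the columns of S from left to right, keep a column iff it is not in
-- the span of the columns kept so far; bs is an echelon basis of that span.
greedy : ∀ {m k} → Vec (Vec Bool m) k → SubsetE k → List (Vec Bool m) → SubsetE k
greedy []       []          bs = []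
greedy (c ∷ cs) (false ∷ S) bs = false ∷ greedy cs S bs
greedy (c ∷ cs) (true ∷ S)  bs = if isZeroVec (reduce bs c)
  then false ∷ greedy cs S bs
  else true ∷ greedy cs S (bs ∷ʳ reduce bs c)

greedyBasis : ∀ {m k} → Vec (Vec Bool m) k → SubsetE k → List (Vec Bool m) → List (Vec Bool m)
greedyBasis []       []          bs = bs
greedyBasis (c ∷ cs) (false ∷ S) bs = greedyBasis cs S bs
greedyBasis (c ∷ cs) (true ∷ S)  bs = if isZeroVec (reduce bs c)
  then greedyBasis cs S bs
  else greedyBasis cs S (bs ∷ʳ reduce bs c)

greedy-⊆ : ∀ {m k} (cs : Vec (Vec Bool m) k) S bs → (greedy cs S bs ⊆ᵇ S) ≡ true
greedy-⊆ []       []          bs = refl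
greedy-⊆ (c ∷ cs) (false ∷ S) bs = greedy-⊆ cs S bs
greedy-⊆ (c ∷ cs) (true ∷ S)  bs with isZeroVec (reduce bs c)
... | true  = greedy-⊆ cs S bs
... | false = greedy-⊆ cs S _

greedyBasis-echelon : ∀ {m k} (cs : Vec (Vec Bool m) k) S bs → Echelon bs → Echelon (greedyBasis cs S bs)
greedyBasis-echelon []       []          bs ech = ech
greedyBasis-echelon (c ∷ cs) (false ∷ S) bs ech = greedyBasis-echelon cs S bs ech
greedyBasis-echelon (c ∷ cs) (true ∷ S)  bs ech with isZeroVec (reduce bs c) in z
... | true  = greedyBasis-echelon cs S bs ech
... | false = greedyBasis-echelon cs S _ (echelon-∷ʳ-reduce bs c ech z)

greedyBasis-mono : ∀ {m k} (cs : Vec (Vec Bool m) k) S bs → ∀ {v} → Span bs v → Span (greedyBasis cs S bs) v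
greedyBasis-mono []       []          bs sv = sv
greedyBasis-mono (c ∷ cs) (false ∷ S) bs sv = greedyBasis-mono cs S bs sv
greedyBasis-mono (c ∷ cs) (true ∷ S)  bs sv with isZeroVec (reduce bs c)
... | true  = greedyBasis-mono cs S bs sv
... | false = greedyBasis-mono cs S _ (span-∷ʳ⁺ sv)

greedyBasis-spans : ∀ {m k} (cs : Vec (Vec Bool m) k) S bs →
                    ∀ T → (T ⊆ᵇ S) ≡ true → Span (greedyBasis cs S bs) (lincomb cs T)
greedyBasis-spans []       []          bs []          _   = span-𝟘
greedyBasis-spans (c ∷ cs) (false ∷ S) bs (false ∷ T) T⊆S = greedyBasis-spans cs S bs T T⊆S
greedyBasis-spans (c ∷ cs) (true ∷ S)  bs (t ∷ T)     T⊆S with isZeroVec (reduce bs c) in z | t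
... | true  | false = greedyBasis-spans cs S bs T T⊆S
... | true  | true  = span-⊕ (greedyBasis-mono cs S bs (reduce≡𝟘⇒span bs c (isZeroVec⇒≡𝟘 _ z)))
                             (greedyBasis-spans cs S bs T T⊆S)
... | false | false = greedyBasis-spans cs S _ T T⊆S
... | false | true  = span-⊕ (greedyBasis-mono cs S _ (span-∷ʳ-reduce bs c))
                             (greedyBasis-spans cs S _ T T⊆S)

length-greedyBasis : ∀ {m k} (cs : Vec (Vec Bool m) k) S bs →
                     length (greedyBasis cs S bs) ≡ length bs ℕ.+ size (greedy cs S bs)
length-greedyBasis []       []          bs = sym (ℕₚ.+-identityʳ _)
length-greedyBasis (c ∷ cs) (false ∷ S) bs = length-greedyBasis cs S bs
length-greedyBasis (c ∷ cs) (true ∷ S)  bs with isZeroVec (reduce bs c)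
... | true  = length-greedyBasis cs S bs
... | false = begin
  length (greedyBasis cs S bs′)               ≡⟨ length-greedyBasis cs S bs′ ⟩
  length bs′ ℕ.+ size (greedy cs S bs′)       ≡⟨ cong (ℕ._+ size (greedy cs S bs′)) (length-++ bs) ⟩
  length bs ℕ.+ 1 ℕ.+ size (greedy cs S bs′)  ≡⟨ ℕₚ.+-assoc (length bs) 1 _ ⟩
  length bs ℕ.+ suc (size (greedy cs S bs′))  ∎
  where
  open ≡-Reasoning
  bs′ = bs ∷ʳ reduce bs c

Independent : ∀ {m k} → Vec (Vec Bool m) k → SubsetE k → Set
Independent cs I = ∀ T → (T ⊆ᵇ I) ≡ true → lincomb cs T ≡ 𝟘 → T ≡ 𝟘

greedy-independentModulo : ∀ {m k} (cs : Vec (Vec Bool m) k) S bs → Echelon bs →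
                           ∀ T → (T ⊆ᵇ greedy cs S bs) ≡ true → Span bs (lincomb cs T) → T ≡ 𝟘
greedy-independentModulo []       []          bs ech []          _   _ = refl
greedy-independentModulo (c ∷ cs) (false ∷ S) bs ech (false ∷ T) T⊆G s =
  cong (false ∷_) (greedy-independentModulo cs S bs ech T T⊆G s)
greedy-independentModulo {m} (c ∷ cs) (true ∷ S) bs ech (t ∷ T) T⊆G s with isZeroVec (reduce bs c) in z | t
... | true  | false = cong (false ∷_) (greedy-independentModulo cs S bs ech T T⊆G s)
... | false | false = cong (false ∷_)
  (greedy-independentModulo cs S _ (echelon-∷ʳ-reduce bs c ech z) T T⊆G (span-∷ʳ⁺ s))
... | false | true  = ⊥-elim (true≢false (trans (sym c-dependent) z))
  where
  T≡𝟘 : T ≡ 𝟘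
  T≡𝟘 = greedy-independentModulo cs S _ (echelon-∷ʳ-reduce bs c ech z) T T⊆G
    (subst (Span _) (⊕-cancelˡ c _) (span-⊕ (span-∷ʳ-reduce bs c) (span-∷ʳ⁺ s)))
  c∈span : Span bs c
  c∈span = subst (Span bs)
    (trans (cong (c ⊕_) (trans (cong (lincomb cs) T≡𝟘) (lincomb-𝟘 cs))) (⊕-identityʳ c)) s
  c-dependent : isZeroVec (reduce bs c) ≡ true
  c-dependent = trans (cong isZeroVec (span⇒reduce≡𝟘 bs ech c∈span)) (isZeroVec-𝟘 m)

greedy-independent : ∀ {m k} (cs : Vec (Vec Bool m) k) S → Independent cs (greedy cs S [])
greedy-independent cs S T T⊆G lincomb≡𝟘 =
  greedy-independentModulo cs S [] tt T T⊆G (subst (Span []) (sym lincomb≡𝟘) span-𝟘)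

-- Upper bound on independent sets

Fin[2^n]↔Vec : ∀ n → Fin (2 ℕ.^ n) ↔ Vec Bool n
Fin[2^n]↔Vec n = ↔-trans (Fin[m^n]↔Fin[m]^n 2 n) (↔-trans (lift↔ n 2↔Bool) (↔Vec n))

↣⇒≤ : ∀ {a b} → Vec Bool a ↣ Vec Bool b → a ≤ b
↣⇒≤ {a} {b} f = ≮⇒≥ λ b<a →
  <⇒≱ (^-monoʳ-< 2 (s≤s (s≤s z≤n)) b<a) (injective⇒≤ (Injection.injective fin-f))
  where
  fin-f : Fin (2 ℕ.^ a) ↣ Fin (2 ℕ.^ b)
  fin-f = ↔⇒↣ (↔-sym (Fin[2^n]↔Vec b)) ↣-∘ (f ↣-∘ ↔⇒↣ (Fin[2^n]↔Vec a))

additive⇒injective : ∀ {a b} (f : Vec Bool a → Vec Bool b) →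
                     (∀ u v → f (u ⊕ v) ≡ f u ⊕ f v) → (∀ u → f u ≡ 𝟘 → u ≡ 𝟘) →
                     Injective _≡_ _≡_ f
additive⇒injective f f-⊕ f-kernel {u} {v} fu≡fv =
  ⊕≡𝟘⇒≡ (f-kernel (u ⊕ v) (trans (f-⊕ u v) (trans (cong (_⊕ f v) fu≡fv) (⊕-self (f v)))))

pivotCoords : ∀ {m} (bs : List (Vec Bool m)) → Vec Bool m → Vec Bool (length bs)
pivotCoords []       w = []
pivotCoords (b ∷ bs) w = atPivot b w ∷ pivotCoords bs w

pivotCoords-⊕ : ∀ {m} (bs : List (Vec Bool m)) u v →
                pivotCoords bs (u ⊕ v) ≡ pivotCoords bs u ⊕ pivotCoords bs v
pivotCoords-⊕ []       u v = refl
pivotCoords-⊕ (b ∷ bs) u v = cong₂ _∷_ (atPivot-⊕ b u v) (pivotCoords-⊕ bs u v)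

pivotCoords≡𝟘⇒vanishes : ∀ {m} (bs : List (Vec Bool m)) w → pivotCoords bs w ≡ 𝟘 → VanishesAtPivots bs w
pivotCoords≡𝟘⇒vanishes []       w _  = []
pivotCoords≡𝟘⇒vanishes (b ∷ bs) w eq = cong head eq ∷ pivotCoords≡𝟘⇒vanishes bs w (cong tail eq)

⊆ᵇ-trans : ∀ {n} (T I S : SubsetE n) → (T ⊆ᵇ I) ≡ true → (I ⊆ᵇ S) ≡ true → (T ⊆ᵇ S) ≡ true
⊆ᵇ-trans []          []          []          _   _   = refl
⊆ᵇ-trans (false ∷ T) (false ∷ I) (s ∷ S)     T⊆I I⊆S = ⊆ᵇ-trans T I S T⊆I I⊆S
⊆ᵇ-trans (false ∷ T) (true ∷ I)  (true ∷ S)  T⊆I I⊆S = ⊆ᵇ-trans T I S T⊆I I⊆S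
⊆ᵇ-trans (true ∷ T)  (true ∷ I)  (true ∷ S)  T⊆I I⊆S = ⊆ᵇ-trans T I S T⊆I I⊆S

expand : ∀ {n} (I : SubsetE n) → Vec Bool (size I) → SubsetE n
expand []          []      = []
expand (true ∷ I)  (b ∷ c) = b ∷ expand I c
expand (false ∷ I) c       = false ∷ expand I c

expand-⊆ : ∀ {n} (I : SubsetE n) c → (expand I c ⊆ᵇ I) ≡ true
expand-⊆ []          []          = refl
expand-⊆ (true ∷ I)  (false ∷ c) = expand-⊆ I c
expand-⊆ (true ∷ I)  (true ∷ c)  = expand-⊆ I c
expand-⊆ (false ∷ I) c           = expand-⊆ I c

expand-⊕ : ∀ {n} (I : SubsetE n) c c′ → expand I (c ⊕ c′) ≡ expand I c ⊕ expand I c′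
expand-⊕ []          []      []        = refl
expand-⊕ (true ∷ I)  (b ∷ c) (b′ ∷ c′) = cong ((b xor b′) ∷_) (expand-⊕ I c c′)
expand-⊕ (false ∷ I) c       c′        = cong (false ∷_) (expand-⊕ I c c′)

expand≡𝟘⇒≡𝟘 : ∀ {n} (I : SubsetE n) c → expand I c ≡ 𝟘 → c ≡ 𝟘
expand≡𝟘⇒≡𝟘 []          []      _  = refl
expand≡𝟘⇒≡𝟘 (true ∷ I)  (b ∷ c) eq = cong₂ _∷_ (cong head eq) (expand≡𝟘⇒≡𝟘 I c (cong tail eq))
expand≡𝟘⇒≡𝟘 (false ∷ I) c       eq = expand≡𝟘⇒≡𝟘 I c (cong tail eq)

independent⇒≤greedy : ∀ {m k} (cs : Vec (Vec Bool m) k) S I →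
                      (I ⊆ᵇ S) ≡ true → Independent cs I → size I ≤ size (greedy cs S [])
independent⇒≤greedy cs S I I⊆S I-indep =
  subst (size I ≤_) (length-greedyBasis cs S []) (↣⇒≤ (mk↣ coords-injective))
  where
  open ≡-Reasoning
  basis = greedyBasis cs S []
  coords : Vec Bool (size I) → Vec Bool (length basis)
  coords c = pivotCoords basis (lincomb cs (expand I c))
  coords-⊕ : ∀ c c′ → coords (c ⊕ c′) ≡ coords c ⊕ coords c′
  coords-⊕ c c′ = begin
    pivotCoords basis (lincomb cs (expand I (c ⊕ c′)))
      ≡⟨ cong (λ T → pivotCoords basis (lincomb cs T)) (expand-⊕ I c c′) ⟩
    pivotCoords basis (lincomb cs (expand I c ⊕ expand I c′))
      ≡⟨ cong (pivotCoords basis) (lincomb-⊕ cs _ _) ⟩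
    pivotCoords basis (lincomb cs (expand I c) ⊕ lincomb cs (expand I c′))
      ≡⟨ pivotCoords-⊕ basis _ _ ⟩
    coords c ⊕ coords c′ ∎
  coords-kernel : ∀ c → coords c ≡ 𝟘 → c ≡ 𝟘
  coords-kernel c coords≡𝟘 = expand≡𝟘⇒≡𝟘 I c (I-indep _ (expand-⊆ I c)
    (echelon-span-vanishing⇒𝟘 basis (greedyBasis-echelon cs S [] tt)
      (greedyBasis-spans cs S [] _ (⊆ᵇ-trans (expand I c) I S (expand-⊆ I c) I⊆S))
      (pivotCoords≡𝟘⇒vanishes basis _ coords≡𝟘)))
  coords-injective : Injective _≡_ _≡_ coords
  coords-injective = additive⇒injective coords coords-⊕ coords-kernel

-- The rank and the Tutte polynomial of a matrix

columns : ∀ {m n} → Matrix m n → Vec (Vec Bool m) n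
columns {n = zero}  A = []
columns {n = suc n} A = mapᵥ head A ∷ columns (mapᵥ tail A)

colSum-[] : ∀ {m} (A : Matrix m 0) → colSum A [] ≡ 𝟘
colSum-[] []       = refl
colSum-[] ([] ∷ A) = cong (false ∷_) (colSum-[] A)

colSum-true : ∀ {m n} (A : Matrix m (suc n)) T →
              colSum A (true ∷ T) ≡ mapᵥ head A ⊕ colSum (mapᵥ tail A) T
colSum-true []            T = refl
colSum-true ((x ∷ r) ∷ A) T = cong₂ _∷_ (cong (_xor rowSum r T) (∧-identityʳ x)) (colSum-true A T)

colSum-false : ∀ {m n} (A : Matrix m (suc n)) T → colSum A (false ∷ T) ≡ colSum (mapᵥ tail A) T
colSum-false []            T = refl
colSum-false ((x ∷ r) ∷ A) T = cong₂ _∷_ (cong (_xor rowSum r T) (∧-zeroʳ x)) (colSum-false A T)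

colSum≡lincomb : ∀ {m n} (A : Matrix m n) T → colSum A T ≡ lincomb (columns A) T
colSum≡lincomb A []          = colSum-[] A
colSum≡lincomb A (true ∷ T)  = trans (colSum-true A T) (cong (mapᵥ head A ⊕_) (colSum≡lincomb (mapᵥ tail A) T))
colSum≡lincomb A (false ∷ T) = trans (colSum-false A T) (colSum≡lincomb (mapᵥ tail A) T)

∈-allSubsets : ∀ {n} (T : SubsetE n) → T ∈ allSubsets n
∈-allSubsets []          = here refl
∈-allSubsets (false ∷ T) = ∈-++⁺ˡ (∈-map⁺ (false ∷_) (∈-allSubsets T))
∈-allSubsets {suc n} (true ∷ T) = ∈-++⁺ʳ (map (false ∷_) (allSubsets n)) (∈-map⁺ (true ∷_) (∈-allSubsets T))

∧≡true⇒ : ∀ {a b} → a ∧ b ≡ true → a ≡ true × b ≡ true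
∧≡true⇒ {true} {true} _ = refl , refl

allᵇ-sound : ∀ {A : Set} (p : A → Bool) L → allᵇ p L ≡ true → ∀ {x} → x ∈ L → p x ≡ true
allᵇ-sound p (y ∷ L) all≡true (here refl) = proj₁ (∧≡true⇒ all≡true)
allᵇ-sound p (y ∷ L) all≡true (there x∈L) = allᵇ-sound p L (proj₂ (∧≡true⇒ {p y} all≡true)) x∈L

allᵇ-complete : ∀ {A : Set} (p : A → Bool) L → (∀ x → p x ≡ true) → allᵇ p L ≡ true
allᵇ-complete p []      _ = refl
allᵇ-complete p (y ∷ L) h rewrite h y = allᵇ-complete p L h

impliesᵇ-elim : ∀ {a b c} → (not a ∨ not b ∨ c) ≡ true → a ≡ true → b ≡ true → c ≡ true
impliesᵇ-elim {true} {true} h refl refl = h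

impliesᵇ-intro : ∀ a b c → (a ≡ true → b ≡ true → c ≡ true) → (not a ∨ not b ∨ c) ≡ true
impliesᵇ-intro false b     c h = refl
impliesᵇ-intro true  false c h = refl
impliesᵇ-intro true  true  c h = h refl refl

independentᵇ⇒Independent : ∀ {m n} (A : Matrix m n) I → independentᵇ A I ≡ true → Independent (columns A) I
independentᵇ⇒Independent {m} {n} A I indep T T⊆I lincomb≡𝟘 =
  isZeroVec⇒≡𝟘 T (trans (sym (isEmpty≡isZeroVec T))
    (impliesᵇ-elim (allᵇ-sound _ (allSubsets n) indep (∈-allSubsets T)) T⊆I
      (trans (cong isZeroVec (trans (colSum≡lincomb A T) lincomb≡𝟘)) (isZeroVec-𝟘 m))))

Independent⇒independentᵇ : ∀ {m n} (A : Matrix m n) I → Independent (columns A) I → independentᵇ A I ≡ true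
Independent⇒independentᵇ {m} {n} A I indep = allᵇ-complete _ (allSubsets n) λ T →
  impliesᵇ-intro (T ⊆ᵇ I) (isZeroVec (colSum A T)) (isEmpty T) λ T⊆I colSum≡𝟘 →
    trans (isEmpty≡isZeroVec T) (subst (λ U → isZeroVec U ≡ true)
      (sym (indep T T⊆I (trans (sym (colSum≡lincomb A T)) (isZeroVec⇒≡𝟘 _ colSum≡𝟘)))) (isZeroVec-𝟘 n))

maxList-filter-≤ : ∀ {A : Set} (f : A → ℕ) (q : A → Bool) L r →
                   (∀ x → q x ≡ true → f x ≤ r) → maxList (map f (filterᵇ q L)) ≤ r
maxList-filter-≤ f q []      r h = z≤n
maxList-filter-≤ f q (x ∷ L) r h with q x in qx
... | true  = ⊔-lub (h x qx) (maxList-filter-≤ f q L r h)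
... | false = maxList-filter-≤ f q L r h

≤-maxList-filter : ∀ {A : Set} (f : A → ℕ) (q : A → Bool) L {x} →
                   x ∈ L → q x ≡ true → f x ≤ maxList (map f (filterᵇ q L))
≤-maxList-filter f q (y ∷ L) (here refl) qx rewrite qx = m≤m⊔n _ _
≤-maxList-filter f q (y ∷ L) (there x∈L) qx with q y
... | true  = ≤-trans (≤-maxList-filter f q L x∈L qx) (m≤n⊔m _ _)
... | false = ≤-maxList-filter f q L x∈L qx

rank≡size-greedy : ∀ {m n} (A : Matrix m n) S → rank A S ≡ size (greedy (columns A) S [])
rank≡size-greedy {n = n} A S = ≤-antisym
  (maxList-filter-≤ size q (allSubsets n) _ λ I qI →
    independent⇒≤greedy (columns A) S I (proj₁ (∧≡true⇒ qI))
      (independentᵇ⇒Independent A I (proj₂ (∧≡true⇒ {I ⊆ᵇ S} qI))))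
  (≤-maxList-filter size q (allSubsets n) (∈-allSubsets G) qG)
  where
  q : SubsetE n → Bool
  q I = (I ⊆ᵇ S) ∧ independentᵇ A I
  G = greedy (columns A) S []
  qG : q G ≡ true
  qG rewrite greedy-⊆ (columns A) S [] = Independent⇒independentᵇ A G (greedy-independent (columns A) S)

-- Σ_T g (r + rank T, s + |T|) over the subsets T of the columns cs, where the
-- greedy state bs is shared by all subsets agreeing on the columns seen so far.
rankSizeSum : ∀ {m k} → (ℕ → ℕ → ℤ) → Vec (Vec Bool m) k → List (Vec Bool m) → ℕ → ℕ → ℤ
rankSizeSum g []       bs r s = g r s
rankSizeSum g (c ∷ cs) bs r s = rankSizeSum g cs bs r s +
  (if isZeroVec (reduce bs c)
   then rankSizeSum g cs bs r (suc s)
   else rankSizeSum g cs (bs ∷ʳ reduce bs c) (suc r) (suc s))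

sumℤ-++ : ∀ xs ys → sumℤ (xs ++ ys) ≡ sumℤ xs + sumℤ ys
sumℤ-++ []       ys = sym (ℤₚ.+-identityˡ _)
sumℤ-++ (x ∷ xs) ys = trans (cong (_+_ x) (sumℤ-++ xs ys)) (sym (ℤₚ.+-assoc x _ _))

rankSizeSum≡sum : ∀ {m k} g (cs : Vec (Vec Bool m) k) bs r s →
  rankSizeSum g cs bs r s ≡ sumℤ (map (λ T → g (r ℕ.+ size (greedy cs T bs)) (s ℕ.+ size T)) (allSubsets k))
rankSizeSum≡sum g [] bs r s =
  trans (cong₂ g (sym (ℕₚ.+-identityʳ r)) (sym (ℕₚ.+-identityʳ s))) (sym (ℤₚ.+-identityʳ _))
rankSizeSum≡sum {k = suc k} g (c ∷ cs) bs r s = begin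
  rankSizeSum g cs bs r s + withC
    ≡⟨ cong₂ _+_ (rankSizeSum≡sum g cs bs r s) withC≡ ⟩
  sumℤ (map (term ∘ (false ∷_)) L) + sumℤ (map (term ∘ (true ∷_)) L)
    ≡⟨ cong₂ _+_ (cong sumℤ (map-∘ L)) (cong sumℤ (map-∘ L)) ⟩
  sumℤ (map term (map (false ∷_) L)) + sumℤ (map term (map (true ∷_) L))
    ≡⟨ sumℤ-++ (map term (map (false ∷_) L)) _ ⟨
  sumℤ (map term (map (false ∷_) L) ++ map term (map (true ∷_) L))
    ≡⟨ cong sumℤ (map-++ term (map (false ∷_) L) _) ⟨
  sumℤ (map term (allSubsets (suc k)))   ∎
  where
  open ≡-Reasoning
  L = allSubsets k
  term : SubsetE (suc k) → ℤ
  term T = g (r ℕ.+ size (greedy (c ∷ cs) T bs)) (s ℕ.+ size T)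
  withC = if isZeroVec (reduce bs c)
          then rankSizeSum g cs bs r (suc s)
          else rankSizeSum g cs (bs ∷ʳ reduce bs c) (suc r) (suc s)
  withC≡ : withC ≡ sumℤ (map (term ∘ (true ∷_)) L)
  withC≡ with isZeroVec (reduce bs c)
  ... | true  = trans (rankSizeSum≡sum g cs bs r (suc s))
    (cong sumℤ (map-cong (λ T → cong (g _) (sym (ℕₚ.+-suc s (size T)))) L))
  ... | false = trans (rankSizeSum≡sum g cs _ (suc r) (suc s))
    (cong sumℤ (map-cong (λ T → cong₂ g (sym (ℕₚ.+-suc r _)) (sym (ℕₚ.+-suc s (size T)))) L))

tutteTerm : ℤ → ℤ → ℕ → ℕ → ℕ → ℤ
tutteTerm t u R r s = (t ^ (R ∸ r)) * (u ^ (s ∸ r))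

tutte≡rankSizeSum : ∀ {m n} (A : Matrix m n) x y →
  tutte A x y ≡ rankSizeSum (tutteTerm (x - + 1) (y - + 1) (size (greedy (columns A) (fullSet n) [])))
                            (columns A) [] 0 0
tutte≡rankSizeSum {n = n} A x y =
  trans (cong sumℤ (map-cong term≡ (allSubsets n))) (sym (rankSizeSum≡sum _ (columns A) [] 0 0))
  where
  term≡ : ∀ S → (x - + 1) ^ (rank A (fullSet n) ∸ rank A S) * (y - + 1) ^ (size S ∸ rank A S)
              ≡ tutteTerm (x - + 1) (y - + 1) (size (greedy (columns A) (fullSet n) []))
                          (size (greedy (columns A) S [])) (size S)
  term≡ S rewrite rank≡size-greedy A S | rank≡size-greedy A (fullSet n) = refl

-- The matroid N′

odd≢even : ∀ k j → + 2 * k + + 1 ≢ + 2 * j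
odd≢even k j odd≡even = 2≢1 (∣1⇒≡1 (divides ∣ j - k ∣ 1≡∣j-k∣*2))
  where
  open ≡-Reasoning
  cancel-even : ∀ k → + 1 ≡ (+ 2 * k + + 1) - + 2 * k
  cancel-even = solve-∀
  factor-two : ∀ j k → + 2 * j - + 2 * k ≡ + 2 * (j - k)
  factor-two = solve-∀
  1≡∣j-k∣*2 : 1 ≡ ∣ j - k ∣ ℕ.* 2
  1≡∣j-k∣*2 = begin
    1                              ≡⟨ cong ∣_∣ (cancel-even k) ⟩
    ∣ (+ 2 * k + + 1) - + 2 * k ∣  ≡⟨ cong (λ i → ∣ i - + 2 * k ∣) odd≡even ⟩
    ∣ + 2 * j - + 2 * k ∣          ≡⟨ cong ∣_∣ (factor-two j k) ⟩
    ∣ + 2 * (j - k) ∣              ≡⟨ ℤₚ.abs-* (+ 2) (j - k) ⟩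
    2 ℕ.* ∣ j - k ∣                ≡⟨ ℕₚ.*-comm 2 ∣ j - k ∣ ⟩
    ∣ j - k ∣ ℕ.* 2                ∎
  2≢1 : 2 ≢ 1
  2≢1 ()

-- The quotient is -368640 / 64 = 2 · (-2880).
not-odd-multiple : ∀ a b → a ≡ + 64 → b ≡ - + 368640 → ¬ ∃ λ k → b ≡ (+ 2 * k + + 1) * a
not-odd-multiple _ _ refl refl (k , eq) =
  odd≢even k (- + 2880) (ℤₚ.*-cancelʳ-≡ (+ 2 * k + + 1) (+ 2 * - + 2880) (+ 64) (sym eq))

-- Any unification problem not solved syntactically makes Agda evaluate
-- tutte by brute force, so the arguments -5 and those of not-odd-multiple are
-- written out exactly as they occur in the theorem.
tutte-N′-at-−1 : tutte N′ (- + 1) (- + 1) ≡ + 64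
tutte-N′-at-−1 = trans (tutte≡rankSizeSum N′ (- + 1) (- + 1)) refl

tutte-N′-at-−5 : tutte N′ (- + 1 + + 4 * - + 1) (- + 1 + + 4 * - + 1) ≡ - + 368640
tutte-N′-at-−5 = trans (tutte≡rankSizeSum N′ (- + 1 + + 4 * - + 1) (- + 1 + + 4 * - + 1)) refl

mainTheorem3 : tutte N′ (- + 1) (- + 1) ≢ + 0
    × ∃ λ (z : ℤ) → ¬ (∃ λ (k : ℤ) →
        tutte N′ (- + 1 + + 4 * z) (- + 1 + + 4 * z)
          ≡ (+ 2 * k + + 1) * tutte N′ (- + 1) (- + 1))
mainTheorem3 =
  (λ T≡0 → 64≢0 (trans (sym tutte-N′-at-−1) T≡0)) ,
  - + 1 ,
  not-odd-multiple (tutte N′ (- + 1) (- + 1)) (tutte N′ (- + 1 + + 4 * - + 1) (- + 1 + + 4 * - + 1))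
    tutte-N′-at-−1 tutte-N′-at-−5
  where
  64≢0 : + 64 ≢ + 0
  64≢0 ()
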